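{- Let $X$ be a set of symbols and let $P,Q,R \subseteq \mathbb{Q}[X]$ be finite sets of polynomials. Let $F$ be the ground conjunctive formula \[ F = \Big(\bigwedge_{p\in P} 0 \le p\Big) \land \Big(\bigwedge_{q \in Q} \lnot (0 \le q)\Big) \land \Big(\bigwedge_{r\in R}\lnot(0 = r)\Big). \] Let $C$ be the least regular cone in $\mathbb{Q}[X]$ that contains $P$. Then $F$ is satisfiable modulo $\mathbf{LRR}$ if and only if $C$ is consistent and $\mathfrak{M}(C) \models F$.
   Context: Atoms with rational coefficients are abbreviations for $\sigma_{or}(X)$-atoms (clear denominators and move terms), where $\sigma_{or}$ has $+,\cdot,0,1,=,\le$ and $\sigma_{or}(X)$ adds $X$ as constants. $\mathbf{LRR}$ is the $\sigma_{or}$-theory axiomatized by: the commutative ring axioms; reflexivity, transitivity and antisymmetry of $\le$; $\forall x,y,z\,(x\le y \Rightarrow x+z\le y+z)$; $0\le 1\land 0\ne 1$; for each integer $n\ge1$, $\exists x\,(x+\dots+x=1)$ ($n$ summands); for each integer $n\ge1$, $\forall x\,(0\le x+\dots+x \Rightarrow 0\le x)$ ($n$ summands). A cone in $\mathbb{Q}[X]$ contains $0$ and is closed under addition and multiplication by non-negative rationals; $\mathrm{units}(C)=\{p: p\in C,-p\in C\}$; $C$ is regular if $1\in C$ and $\mathrm{units}(C)$ is an ideal; consistent if $C\ne \mathbb{Q}[X]$. $\mathfrak{M}(C)$ is the $\sigma_{or}(X)$-structure with universe and ring operations those of $\mathbb{Q}[X]/I$, $I = \mathrm{units}(C)$, each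 $x\in X$ interpreted as $x+I$, and $\le$ interpreted as $\{(p+I,q+I): q-p\in C\}$. -}

module Defs where

open import Data.Nat as ℕ using (ℕ; zero; suc)
open import Data.Integer as ℤ using (ℤ; +_; -[1+_])
open import Data.Rational as ℚ using (ℚ; 0ℚ; 1ℚ)
open import Data.List using (List; []; _∷_; map; _++_)
open import Data.List.Relation.Unary.All using (All)
open import Data.Product using (Σ; _×_; _,_; ∃)
open import Relation.Nullary using (¬_)
open import Relation.Binary.PropositionalEquality using (_≡_)

-- ℚ[X]: the free commutative ℚ-algebra on the set X, presented as
-- polynomial expressions modulo the congruence generated by the
-- commutative-ring axioms and the requirement that constants form a
-- ring homomorphism ℚ → ℚ[X].  (A setoid; Agda has no quotients.)

infixl 6 _⊞_
infixl 7 _⊠_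

data Poly (X : Set) : Set where
  var : X → Poly X
  con : ℚ → Poly X
  _⊞_ : Poly X → Poly X → Poly X
  _⊠_ : Poly X → Poly X → Poly X

module _ {X : Set} where

  ⊟_ : Poly X → Poly X
  ⊟ p = con (ℚ.- 1ℚ) ⊠ p

  _⊟_ : Poly X → Poly X → Poly X
  p ⊟ q = p ⊞ ⊟ q

  infix 4 _≈ₚ_
  data _≈ₚ_ : Poly X → Poly X → Set where
    refl≈  : ∀ {p} → p ≈ₚ p
    sym≈   : ∀ {p q} → p ≈ₚ q → q ≈ₚ p
    trans≈ : ∀ {p q r} → p ≈ₚ q → q ≈ₚ r → p ≈ₚ r
    ⊞-cong : ∀ {p p' q q'} → p ≈ₚ p' → q ≈ₚ q' → p ⊞ q ≈ₚ p' ⊞ q'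
    ⊠-cong : ∀ {p p' q q'} → p ≈ₚ p' → q ≈ₚ q' → p ⊠ q ≈ₚ p' ⊠ q'
    ⊞-assoc : ∀ p q r → (p ⊞ q) ⊞ r ≈ₚ p ⊞ (q ⊞ r)
    ⊞-comm  : ∀ p q → p ⊞ q ≈ₚ q ⊞ p
    ⊞-idʳ   : ∀ p → p ⊞ con 0ℚ ≈ₚ p
    ⊞-invʳ  : ∀ p → p ⊞ (⊟ p) ≈ₚ con 0ℚ
    ⊠-assoc : ∀ p q r → (p ⊠ q) ⊠ r ≈ₚ p ⊠ (q ⊠ r)
    ⊠-comm  : ∀ p q → p ⊠ q ≈ₚ q ⊠ p
    ⊠-idʳ   : ∀ p → p ⊠ con 1ℚ ≈ₚ p
    distribˡ : ∀ p q r → p ⊠ (q ⊞ r) ≈ₚ (p ⊠ q) ⊞ (p ⊠ r)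
    con-+   : ∀ a b → con (a ℚ.+ b) ≈ₚ con a ⊞ con b
    con-*   : ∀ a b → con (a ℚ.* b) ≈ₚ con a ⊠ con b

  Subset : Set₁
  Subset = Poly X → Set

  Respects≈ : Subset → Set
  Respects≈ C = ∀ {p q} → p ≈ₚ q → C p → C q

  record IsCone (C : Subset) : Set where
    field
      respects : Respects≈ C
      has-0    : C (con 0ℚ)
      closed-+ : ∀ {p q} → C p → C q → C (p ⊞ q)
      closed-nonneg-scale : ∀ {a p} → 0ℚ ℚ.≤ a → C p → C (con a ⊠ p)

  units : Subset → Subset
  units C p = C p × C (⊟ p)

  record IsIdeal (I : Subset) : Set where
    field
      respects : Respects≈ I
      has-0    : I (con 0ℚ)
      closed-+ : ∀ {p q} → I p → I q → I (p ⊞ q)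
      closed-neg : ∀ {p} → I p → I (⊟ p)
      closed-mul : ∀ r {p} → I p → I (r ⊠ p)

  record IsRegular (C : Subset) : Set where
    field
      has-1 : C (con 1ℚ)
      units-ideal : IsIdeal (units C)

  IsConsistent : Subset → Set
  IsConsistent C = ¬ (∀ p → C p)

  record IsLeastRegularConeContaining (P : List (Poly X)) (C : Subset) : Set₁ where
    field
      cone     : IsCone C
      regular  : IsRegular C
      contains : All C P
      least    : ∀ (D : Subset) → IsCone D → IsRegular D → All D P →
                 ∀ p → C p → D p

-- The equality symbol is
-- interpreted by a relation _≈_ (setoid semantics); the equality axioms
-- (equivalence + congruence) are part of being a model, see IsLRR.

data Term (X : Set) : Set where
  tvar : X → Term X
  t0 t1 : Term X
  _t+_ _t*_ : Term X → Term X → Term X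

record Structure (X : Set) : Set₁ where
  field
    Carrier : Set
    _≈_  : Carrier → Carrier → Set
    _⊕_  : Carrier → Carrier → Carrier
    _⊗_  : Carrier → Carrier → Carrier
    𝟘 𝟙  : Carrier
    _≼_  : Carrier → Carrier → Set
    ⟦_⟧ᵛ : X → Carrier

  eval : Term X → Carrier
  eval (tvar x) = ⟦ x ⟧ᵛ
  eval t0 = 𝟘
  eval t1 = 𝟙
  eval (s t+ t) = eval s ⊕ eval t
  eval (s t* t) = eval s ⊗ eval t

  -- rep n x = x + ... + x  with (suc n) summands
  rep : ℕ → Carrier → Carrier
  rep zero x = x
  rep (suc n) x = x ⊕ rep n x

record IsLRR {X : Set} (M : Structure X) : Set where
  open Structure M
  field
    ≈-refl  : ∀ {x} → x ≈ x
    ≈-sym   : ∀ {x y} → x ≈ y → y ≈ x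
    ≈-trans : ∀ {x y z} → x ≈ y → y ≈ z → x ≈ z
    ⊕-cong  : ∀ {x x' y y'} → x ≈ x' → y ≈ y' → (x ⊕ y) ≈ (x' ⊕ y')
    ⊗-cong  : ∀ {x x' y y'} → x ≈ x' → y ≈ y' → (x ⊗ y) ≈ (x' ⊗ y')
    ≼-cong  : ∀ {x x' y y'} → x ≈ x' → y ≈ y' → x ≼ y → x' ≼ y'
    ⊕-assoc : ∀ x y z → ((x ⊕ y) ⊕ z) ≈ (x ⊕ (y ⊕ z))
    ⊕-comm  : ∀ x y → (x ⊕ y) ≈ (y ⊕ x)
    ⊕-idʳ   : ∀ x → (x ⊕ 𝟘) ≈ x
    ⊕-inv   : ∀ x → ∃ λ y → (x ⊕ y) ≈ 𝟘
    ⊗-assoc : ∀ x y z → ((x ⊗ y) ⊗ z) ≈ (x ⊗ (y ⊗ z))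
    ⊗-comm  : ∀ x y → (x ⊗ y) ≈ (y ⊗ x)
    ⊗-idʳ   : ∀ x → (x ⊗ 𝟙) ≈ x
    distrib : ∀ x y z → (x ⊗ (y ⊕ z)) ≈ ((x ⊗ y) ⊕ (x ⊗ z))
    ≼-refl    : ∀ x → x ≼ x
    ≼-trans   : ∀ {x y z} → x ≼ y → y ≼ z → x ≼ z
    ≼-antisym : ∀ {x y} → x ≼ y → y ≼ x → x ≈ y
    ≼-+       : ∀ {x y} z → x ≼ y → (x ⊕ z) ≼ (y ⊕ z)
    0≼1  : 𝟘 ≼ 𝟙
    0≉1  : ¬ (𝟘 ≈ 𝟙)
    -- for each n ≥ 1 (here n = suc k summands)
    divisible : ∀ k → ∃ λ x → rep k x ≈ 𝟙
    torsion-free-order : ∀ k x → 𝟘 ≼ rep k x → 𝟘 ≼ x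

-- Atoms with rational coefficients as abbreviations of σ_or(X)-atoms:
-- for a polynomial expression p we compute d > 0 and terms a, b with
-- natural-number coefficients such that d·p = a − b in ℚ[X]; then
-- "0 ≤ p" abbreviates "b ≤ a" and "0 = p" abbreviates "b = a".

numeral : {X : Set} → ℕ → Term X
numeral zero = t0
numeral (suc n) = t1 t+ numeral n

record Cleared (X : Set) : Set where
  constructor cleared
  field
    den : ℕ
    pos neg : Term X

clear : {X : Set} → Poly X → Cleared X
clear (var x) = cleared 1 (tvar x) t0
clear (con q) with ℚ.numerator q
... | + k      = cleared (ℚ.denominatorℕ q) (numeral k) t0
... | -[1+ k ] = cleared (ℚ.denominatorℕ q) t0 (numeral (suc k))
clear (p ⊞ q) with clear p | clear q
... | cleared d₁ a₁ b₁ | cleared d₂ a₂ b₂ =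
  cleared (d₁ ℕ.* d₂) ((numeral d₂ t* a₁) t+ (numeral d₁ t* a₂))
                      ((numeral d₂ t* b₁) t+ (numeral d₁ t* b₂))
clear (p ⊠ q) with clear p | clear q
... | cleared d₁ a₁ b₁ | cleared d₂ a₂ b₂ =
  cleared (d₁ ℕ.* d₂) ((a₁ t* a₂) t+ (b₁ t* b₂)) ((a₁ t* b₂) t+ (b₁ t* a₂))

data Literal (X : Set) : Set where
  0≤_   : Poly X → Literal X
  ¬0≤_  : Poly X → Literal X
  ¬0=_  : Poly X → Literal X

module _ {X : Set} (M : Structure X) where
  open Structure M

  Sat0≤ : Poly X → Set
  Sat0≤ p = eval (Cleared.neg (clear p)) ≼ eval (Cleared.pos (clear p))

  Sat0= : Poly X → Set
  Sat0= p = eval (Cleared.neg (clear p)) ≈ eval (Cleared.pos (clear p))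

  SatLit : Literal X → Set
  SatLit (0≤ p)  = Sat0≤ p
  SatLit (¬0≤ p) = ¬ Sat0≤ p
  SatLit (¬0= p) = ¬ Sat0= p

_⊨_ : {X : Set} → Structure X → List (Literal X) → Set
M ⊨ F = All (SatLit M) F

formulaF : {X : Set} → List (Poly X) → List (Poly X) → List (Poly X) → List (Literal X)
formulaF P Q R = map 0≤_ P ++ map ¬0≤_ Q ++ map ¬0=_ R

SatisfiableModLRR : {X : Set} → List (Literal X) → Set₁
SatisfiableModLRR {X} F = Σ (Structure X) λ M → IsLRR M × M ⊨ F

-- 𝔐(C): universe ℚ[X]/units(C) (as a setoid on ℚ[X]), x ↦ x + I,
-- p + I ≤ q + I iff q − p ∈ C.
𝔐 : {X : Set} → (Poly X → Set) → Structure X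
𝔐 {X} C = record
  { Carrier = Poly X
  ; _≈_ = λ p q → units C (p ⊟ q)
  ; _⊕_ = _⊞_
  ; _⊗_ = _⊠_
  ; 𝟘 = con 0ℚ
  ; 𝟙 = con 1ℚ
  ; _≼_ = λ p q → C (q ⊟ p)
  ; ⟦_⟧ᵛ = var
  }

module Submission where

-- Evaluation ⟦_⟧ : ℚ[X] → M into a model M of LRR is a ring homomorphism: divisibility and
-- torsion-freeness give a unique embedding of ℚ into M, and clearing denominators shows that
-- M satisfies 0 ≤ p (resp. 0 = p) exactly when 0 ≤ ⟦p⟧ (resp. ⟦p⟧ = 0). So the preimage of
-- the non-negative elements of M is a regular cone containing P; it contains C, which
-- excludes −1 from C (consistency) and transfers the negative literals of F from M to 𝔐(C).
-- Conversely, for a consistent regular cone C the structure 𝔐(C) is itself a model of LRR,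
-- and evaluation in it is the identity modulo units(C), so 𝔐(C) ⊨ 0 ≤ p iff p ∈ C.

open import Defs
open import Algebra using (CommutativeRing)
open import Algebra.Structures using (IsCommutativeRing)
open import Algebra.Solver.Ring.AlmostCommutativeRing
  using (fromCommutativeRing; _-Raw-AlmostCommutative⟶_)
import Algebra.Solver.Ring as RingSolver
open import Data.Maybe using (Maybe; just; nothing)
open import Data.Nat as ℕ using (ℕ; zero; suc)
import Data.Nat.Properties as ℕ
import Data.Nat.Coprimality as Coprimality
open import Data.Integer as ℤ using (ℤ; +_; -[1+_]; _⊖_; _◃_; sign; ∣_∣)
import Data.Integer.Properties as ℤ
open import Data.Integer.Solver using (module +-*-Solver)
open import Data.Sign as Sign using (Sign)
open import Data.Rational as ℚ using (ℚ; 0ℚ; 1ℚ; mkℚ)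
import Data.Rational.Properties as ℚ
open import Data.Rational.Unnormalised as ℚᵘ using (ℚᵘ; mkℚᵘ; *≡*)
import Data.Rational.Unnormalised.Properties as ℚᵘ
open import Level using (0ℓ)
open import Relation.Binary.Bundles using (Setoid)
open import Relation.Binary.Structures using (IsEquivalence)
open import Relation.Binary.PropositionalEquality as ≡ using (_≡_)
open import Relation.Nullary using (¬_; yes; no)
open import Data.Product using (_,_; proj₁; proj₂; ∃)
open import Data.List using (List; map)
open import Data.List.Relation.Unary.All as All using (All)
open import Data.List.Relation.Unary.All.Properties using (map⁺; map⁻; ++⁺; ++⁻)
open import Function.Bundles using (_⇔_; mk⇔; Equivalence)

record IsCommutativeRingʳ {A : Set} (_≈_ : A → A → Set)
         (_+_ _*_ : A → A → A) (-_ : A → A) (0# 1# : A) : Set where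
  field
    isEquivalence : IsEquivalence _≈_
    +-cong     : ∀ {x x′ y y′} → x ≈ x′ → y ≈ y′ → (x + y) ≈ (x′ + y′)
    *-cong     : ∀ {x x′ y y′} → x ≈ x′ → y ≈ y′ → (x * y) ≈ (x′ * y′)
    -‿cong     : ∀ {x x′} → x ≈ x′ → (- x) ≈ (- x′)
    +-assoc    : ∀ x y z → ((x + y) + z) ≈ (x + (y + z))
    +-comm     : ∀ x y → (x + y) ≈ (y + x)
    +-identityʳ : ∀ x → (x + 0#) ≈ x
    -‿inverseʳ : ∀ x → (x + (- x)) ≈ 0#
    *-assoc    : ∀ x y z → ((x * y) * z) ≈ (x * (y * z))
    *-comm     : ∀ x y → (x * y) ≈ (y * x)
    *-identityʳ : ∀ x → (x * 1#) ≈ x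
    *-distribˡ-+ : ∀ x y z → (x * (y + z)) ≈ ((x * y) + (x * z))

  open IsEquivalence isEquivalence

  isCommutativeRing : IsCommutativeRing _≈_ _+_ _*_ -_ 0# 1#
  isCommutativeRing = record
    { isRing = record
      { +-isAbelianGroup = record
        { isGroup = record
          { isMonoid = record
            { isSemigroup = record
              { isMagma = record { isEquivalence = isEquivalence ; ∙-cong = +-cong }
              ; assoc = +-assoc }
            ; identity = (λ x → trans (+-comm _ x) (+-identityʳ x)) , +-identityʳ }
          ; inverse = (λ x → trans (+-comm _ x) (-‿inverseʳ x)) , -‿inverseʳ
          ; ⁻¹-cong = -‿cong }
        ; comm = +-comm }
      ; *-cong = *-cong
      ; *-assoc = *-assoc
      ; *-identity = (λ x → trans (*-comm _ x) (*-identityʳ x)) , *-identityʳ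
      ; distrib = *-distribˡ-+ , λ x y z →
          trans (*-comm _ x) (trans (*-distribˡ-+ x y z) (+-cong (*-comm x y) (*-comm x z))) }
    ; *-comm = *-comm }

module IntegerEmbedding (R : CommutativeRing 0ℓ 0ℓ) where
  open CommutativeRing R
  open import Algebra.Properties.Ring ring
  open import Algebra.Properties.Semiring.Mult semiring public using (_×_; ×-congʳ; ×-congˡ; ×1-homo-*)
  open import Algebra.Properties.Semiring.Mult semiring using (×-homo-+; ×-assoc-*)
  open import Algebra.Properties.CommutativeSemigroup +-commutativeSemigroup using (interchange)
  open import Relation.Binary.Reasoning.Setoid setoid

  ×-homo-‿ : ∀ n x → n × (- x) ≈ - (n × x)
  ×-homo-‿ zero x = sym -0#≈0#
  ×-homo-‿ (suc n) x = trans (+-congˡ (×-homo-‿ n x)) (-‿+-comm x (n × x))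

  ×-zeroʳ : ∀ n → n × 0# ≈ 0#
  ×-zeroʳ zero = refl
  ×-zeroʳ (suc n) = trans (+-identityˡ _) (×-zeroʳ n)

  ×1*≈× : ∀ n x → (n × 1#) * x ≈ n × x
  ×1*≈× n x = trans (×-assoc-* n 1# x) (×-congʳ n (*-identityˡ x))

  ι : ℤ → Carrier
  ι (+ n) = n × 1#
  ι -[1+ n ] = - (suc n × 1#)

  ι-⊖ : ∀ m n → ι (m ⊖ n) ≈ m × 1# - n × 1#
  ι-⊖ m zero = sym (trans (+-congˡ -0#≈0#) (+-identityʳ _))
  ι-⊖ zero (suc n) = sym (+-identityˡ _)
  ι-⊖ (suc m) (suc n) = begin
    ι (suc m ⊖ suc n)               ≡⟨ ≡.cong ι (ℤ.[1+m]⊖[1+n]≡m⊖n m n) ⟩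
    ι (m ⊖ n)                       ≈⟨ ι-⊖ m n ⟩
    m × 1# - n × 1#                 ≈⟨ +-identityˡ _ ⟨
    0# + (m × 1# - n × 1#)          ≈⟨ +-congʳ (-‿inverseʳ 1#) ⟨
    (1# - 1#) + (m × 1# - n × 1#)   ≈⟨ interchange 1# (- 1#) (m × 1#) (- (n × 1#)) ⟩
    (1# + m × 1#) + (- 1# - n × 1#) ≈⟨ +-congˡ (-‿+-comm 1# (n × 1#)) ⟩
    (1# + m × 1#) - (1# + n × 1#)   ∎

  +-homo : ∀ i j → ι (i ℤ.+ j) ≈ ι i + ι j
  +-homo (+ m) (+ n) = ×-homo-+ 1# m n
  +-homo (+ m) -[1+ n ] = ι-⊖ m (suc n)
  +-homo -[1+ m ] (+ n) = trans (ι-⊖ n (suc m)) (+-comm _ _)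
  +-homo -[1+ m ] -[1+ n ] = begin
    - (suc (suc (m ℕ.+ n)) × 1#)        ≡⟨ ≡.cong (λ k → - (suc k × 1#)) (ℕ.+-suc m n) ⟨
    - ((suc m ℕ.+ suc n) × 1#)          ≈⟨ -‿cong (×-homo-+ 1# (suc m) (suc n)) ⟩
    - (suc m × 1# + suc n × 1#)         ≈⟨ -‿+-comm _ _ ⟨
    - (suc m × 1#) + - (suc n × 1#)     ∎

  private
    signed : Sign → Carrier → Carrier
    signed Sign.+ x = x
    signed Sign.- x = - x

    signed-cong : ∀ s {x y} → x ≈ y → signed s x ≈ signed s y
    signed-cong Sign.+ x≈y = x≈y
    signed-cong Sign.- x≈y = -‿cong x≈y

    signed-* : ∀ s t x y → signed (s Sign.* t) (x * y) ≈ signed s x * signed t y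
    signed-* Sign.+ Sign.+ x y = refl
    signed-* Sign.+ Sign.- x y = -‿distribʳ-* x y
    signed-* Sign.- Sign.+ x y = -‿distribˡ-* x y
    signed-* Sign.- Sign.- x y = begin
      x * y         ≈⟨ -‿involutive _ ⟨
      - - (x * y)   ≈⟨ -‿cong (-‿distribʳ-* x y) ⟩
      - (x * - y)   ≈⟨ -‿distribˡ-* x (- y) ⟩
      - x * - y     ∎

    ι-◃ : ∀ s n → ι (s ◃ n) ≈ signed s (n × 1#)
    ι-◃ Sign.+ zero = refl
    ι-◃ Sign.- zero = sym -0#≈0#
    ι-◃ Sign.+ (suc n) = refl
    ι-◃ Sign.- (suc n) = refl

    ι-sign-abs : ∀ i → ι i ≈ signed (sign i) (∣ i ∣ × 1#)
    ι-sign-abs (+ n) = refl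
    ι-sign-abs -[1+ n ] = refl

  *-homo : ∀ i j → ι (i ℤ.* j) ≈ ι i * ι j
  *-homo i j = begin
    ι (i ℤ.* j)
      ≈⟨ ι-◃ (sign i Sign.* sign j) (∣ i ∣ ℕ.* ∣ j ∣) ⟩
    signed (sign i Sign.* sign j) ((∣ i ∣ ℕ.* ∣ j ∣) × 1#)
      ≈⟨ signed-cong (sign i Sign.* sign j) (×1-homo-* ∣ i ∣ ∣ j ∣) ⟩
    signed (sign i Sign.* sign j) (∣ i ∣ × 1# * ∣ j ∣ × 1#)
      ≈⟨ signed-* (sign i) (sign j) _ _ ⟩
    signed (sign i) (∣ i ∣ × 1#) * signed (sign j) (∣ j ∣ × 1#)
      ≈⟨ *-cong (ι-sign-abs i) (ι-sign-abs j) ⟨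
    ι i * ι j ∎

  -‿homo : ∀ i → ι (ℤ.- i) ≈ - ι i
  -‿homo (+ zero) = sym -0#≈0#
  -‿homo (+ suc n) = refl
  -‿homo -[1+ n ] = sym (-‿involutive _)

  homomorphism : ℤ.+-*-rawRing -Raw-AlmostCommutative⟶ fromCommutativeRing R
  homomorphism = record
    { ⟦_⟧ = ι ; +-homo = +-homo ; *-homo = *-homo ; -‿homo = -‿homo
    ; 0-homo = refl ; 1-homo = +-identityʳ 1# }

  private
    ι-≟ : ∀ i j → Maybe (ι i ≈ ι j)
    ι-≟ i j with i ℤ.≟ j
    ... | yes i≡j = just (reflexive (≡.cong ι i≡j))
    ... | no _ = nothing

  open RingSolver ℤ.+-*-rawRing (fromCommutativeRing R) homomorphism ι-≟
    public using (solve; _:+_; _:*_; _:-_; :-_; _:=_; con)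

fromℤ : ℤ → ℚ
fromℤ z = mkℚ z 0 (Coprimality.sym (Coprimality.1-coprimeTo _))

fromℤ-suc : ∀ n → 1ℚ ℚ.+ fromℤ (+ n) ≡ fromℤ (+ suc n)
fromℤ-suc n = ℚ.toℚᵘ-injective (ℚᵘ.≃-trans (ℚ.toℚᵘ-homo-+ 1ℚ (fromℤ (+ n))) (*≡* cross))
  where
  open +-*-Solver
  cross : (+ 1 ℤ.+ + n ℤ.* + 1) ℤ.* + 1 ≡ (+ 1 ℤ.+ + n) ℤ.* (+ 1 ℤ.* + 1)
  cross = solve 1 (λ n → (con (+ 1) :+ n :* con (+ 1)) :* con (+ 1)
                       := (con (+ 1) :+ n) :* (con (+ 1) :* con (+ 1))) ≡.refl (+ n)

fromℤ-↧*≡↥ : ∀ q → fromℤ (ℚ.↧ q) ℚ.* q ≡ fromℤ (ℚ.↥ q)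
fromℤ-↧*≡↥ q@(mkℚ n d _) = ℚ.toℚᵘ-injective (ℚᵘ.≃-trans (ℚ.toℚᵘ-homo-* (fromℤ (ℚ.↧ q)) q) (*≡* cross))
  where
  open +-*-Solver
  cross : (+ suc d ℤ.* n) ℤ.* + 1 ≡ n ℤ.* (+ 1 ℤ.* + suc d)
  cross = solve 2 (λ d n → (d :* n) :* con (+ 1) := n :* (con (+ 1) :* d)) ≡.refl (+ suc d) n

1/suc : ℕ → ℚ
1/suc k = mkℚ (+ 1) k (Coprimality.1-coprimeTo _)

0≤1/suc : ∀ k → 0ℚ ℚ.≤ 1/suc k
0≤1/suc k = ℚ.*≤* (ℤ.+≤+ ℕ.z≤n)

module Polynomials {X : Set} where

  isCommutativeRingʳ : IsCommutativeRingʳ (_≈ₚ_ {X}) _⊞_ _⊠_ ⊟_ (con 0ℚ) (con 1ℚ)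
  isCommutativeRingʳ = record
    { isEquivalence = record { refl = refl≈ ; sym = sym≈ ; trans = trans≈ }
    ; +-cong = ⊞-cong ; *-cong = ⊠-cong ; -‿cong = ⊠-cong refl≈
    ; +-assoc = ⊞-assoc ; +-comm = ⊞-comm ; +-identityʳ = ⊞-idʳ ; -‿inverseʳ = ⊞-invʳ
    ; *-assoc = ⊠-assoc ; *-comm = ⊠-comm ; *-identityʳ = ⊠-idʳ ; *-distribˡ-+ = distribˡ }

  commutativeRing : CommutativeRing 0ℓ 0ℓ
  commutativeRing = record
    { isCommutativeRing = IsCommutativeRingʳ.isCommutativeRing isCommutativeRingʳ }

  open IntegerEmbedding commutativeRing public
  open import Relation.Binary.Reasoning.Setoid (CommutativeRing.setoid commutativeRing)

  con-cong : ∀ {a b} → a ≡ b → con {X} a ≈ₚ con b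
  con-cong ≡.refl = refl≈

  ×1≈ₚcon∘fromℤ : ∀ n → n × con 1ℚ ≈ₚ con (fromℤ (+ n))
  ×1≈ₚcon∘fromℤ zero = refl≈
  ×1≈ₚcon∘fromℤ (suc n) = begin
    con 1ℚ ⊞ n × con 1ℚ            ≈⟨ ⊞-cong refl≈ (×1≈ₚcon∘fromℤ n) ⟩
    con 1ℚ ⊞ con (fromℤ (+ n))     ≈⟨ con-+ 1ℚ (fromℤ (+ n)) ⟨
    con (1ℚ ℚ.+ fromℤ (+ n))       ≈⟨ con-cong (fromℤ-suc n) ⟩
    con (fromℤ (+ suc n))          ∎

  ι≈ₚcon∘fromℤ : ∀ z → ι z ≈ₚ con (fromℤ z)
  ι≈ₚcon∘fromℤ (+ n) = ×1≈ₚcon∘fromℤ n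
  ι≈ₚcon∘fromℤ -[1+ n ] = begin
    ⊟ (suc n × con 1ℚ)                     ≈⟨ ⊠-cong refl≈ (×1≈ₚcon∘fromℤ (suc n)) ⟩
    con (ℚ.- 1ℚ) ⊠ con (fromℤ (+ suc n))   ≈⟨ con-* (ℚ.- 1ℚ) _ ⟨
    con (ℚ.- 1ℚ ℚ.* fromℤ (+ suc n))       ≈⟨ con-cong (-1*x≈-x (fromℤ (+ suc n))) ⟩
    con (fromℤ -[1+ n ])                   ∎
    where open import Algebra.Properties.Ring ℚ.+-*-ring using (-1*x≈-x)

  ι↧⊠con≈ₚι↥ : ∀ q → ι (ℚ.↧ q) ⊠ con q ≈ₚ ι (ℚ.↥ q)
  ι↧⊠con≈ₚι↥ q = begin
    ι (ℚ.↧ q) ⊠ con q               ≈⟨ ⊠-cong (ι≈ₚcon∘fromℤ (ℚ.↧ q)) refl≈ ⟩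
    con (fromℤ (ℚ.↧ q)) ⊠ con q     ≈⟨ con-* _ q ⟨
    con (fromℤ (ℚ.↧ q) ℚ.* q)       ≈⟨ con-cong (fromℤ-↧*≡↥ q) ⟩
    con (fromℤ (ℚ.↥ q))             ≈⟨ ι≈ₚcon∘fromℤ (ℚ.↥ q) ⟨
    ι (ℚ.↥ q)                       ∎

clear-den≡suc : {X : Set} (p : Poly X) → ∃ λ k → Cleared.den (clear p) ≡ suc k
clear-den≡suc (var x) = 0 , ≡.refl
clear-den≡suc (con (mkℚ (+ _) d _)) = d , ≡.refl
clear-den≡suc (con (mkℚ -[1+ _ ] d _)) = d , ≡.refl
clear-den≡suc (p ⊞ q) with clear p | clear-den≡suc p | clear q | clear-den≡suc q
... | cleared _ _ _ | _ , ≡.refl | cleared _ _ _ | _ , ≡.refl = _ , ≡.refl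
clear-den≡suc (p ⊠ q) with clear p | clear-den≡suc p | clear q | clear-den≡suc q
... | cleared _ _ _ | _ , ≡.refl | cleared _ _ _ | _ , ≡.refl = _ , ≡.refl

module LRRModel {X : Set} (M : Structure X) (isLRR : IsLRR M) where
  open Structure M
  open IsLRR isLRR

  private
    negate : Carrier → Carrier
    negate x = proj₁ (⊕-inv x)

    isEquivalence : IsEquivalence _≈_
    isEquivalence = record { refl = ≈-refl ; sym = ≈-sym ; trans = ≈-trans }

    ≈-setoid : Setoid 0ℓ 0ℓ
    ≈-setoid = record { isEquivalence = isEquivalence }

    negate-cong : ∀ {x y} → x ≈ y → negate x ≈ negate y
    negate-cong {x} {y} x≈y = begin
      negate x                         ≈⟨ ⊕-idʳ _ ⟨
      negate x ⊕ 𝟘                     ≈⟨ ⊕-cong ≈-refl (proj₂ (⊕-inv y)) ⟨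
      negate x ⊕ (y ⊕ negate y)        ≈⟨ ⊕-assoc _ _ _ ⟨
      (negate x ⊕ y) ⊕ negate y        ≈⟨ ⊕-cong (⊕-cong ≈-refl x≈y) ≈-refl ⟨
      (negate x ⊕ x) ⊕ negate y        ≈⟨ ⊕-cong (⊕-comm _ _) ≈-refl ⟩
      (x ⊕ negate x) ⊕ negate y        ≈⟨ ⊕-cong (proj₂ (⊕-inv x)) ≈-refl ⟩
      𝟘 ⊕ negate y                     ≈⟨ ⊕-comm _ _ ⟩
      negate y ⊕ 𝟘                     ≈⟨ ⊕-idʳ _ ⟩
      negate y                         ∎
      where open import Relation.Binary.Reasoning.Setoid ≈-setoid

  commutativeRing : CommutativeRing 0ℓ 0ℓ
  commutativeRing = record
    { isCommutativeRing = IsCommutativeRingʳ.isCommutativeRing (record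
      { isEquivalence = isEquivalence
      ; +-cong = ⊕-cong ; *-cong = ⊗-cong ; -‿cong = negate-cong
      ; +-assoc = ⊕-assoc ; +-comm = ⊕-comm ; +-identityʳ = ⊕-idʳ ; -‿inverseʳ = λ x → proj₂ (⊕-inv x)
      ; *-assoc = ⊗-assoc ; *-comm = ⊗-comm ; *-identityʳ = ⊗-idʳ ; *-distribˡ-+ = distrib }) }

  open CommutativeRing commutativeRing public
    using (-_; _-_; -‿cong; +-identityˡ; zeroˡ; zeroʳ; setoid; ring)
  open import Algebra.Properties.Ring ring public using (-0#≈0#; -1*x≈-x)
  open IntegerEmbedding commutativeRing public
  open import Relation.Binary.Reasoning.Setoid setoid
  open import Algebra.Properties.AbelianGroup (CommutativeRing.+-abelianGroup commutativeRing)
    using (x∙y⁻¹≈ε⇒x≈y; x≈y⇒x∙y⁻¹≈ε)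

  x≼y⇒0≼y-x : ∀ {x y} → x ≼ y → 𝟘 ≼ (y - x)
  x≼y⇒0≼y-x {x} x≼y = ≼-cong (proj₂ (⊕-inv x)) ≈-refl (≼-+ (- x) x≼y)

  0≼y-x⇒x≼y : ∀ {x y} → 𝟘 ≼ (y - x) → x ≼ y
  0≼y-x⇒x≼y {x} {y} 0≼y-x =
    ≼-cong (+-identityˡ x) (solve 2 (λ x y → (y :- x) :+ x := y) ≈-refl x y) (≼-+ x 0≼y-x)

  0≼⊕ : ∀ {x y} → 𝟘 ≼ x → 𝟘 ≼ y → 𝟘 ≼ (x ⊕ y)
  0≼⊕ {x} {y} 0≼x 0≼y = ≼-trans 0≼x (≼-cong (+-identityˡ x) (⊕-comm y x) (≼-+ x 0≼y))

  0≼-antisym : ∀ {x} → 𝟘 ≼ x → 𝟘 ≼ (- x) → x ≈ 𝟘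
  0≼-antisym 0≼x 0≼-x = ≈-sym (≼-antisym 0≼x (0≼y-x⇒x≼y (≼-cong ≈-refl (≈-sym (+-identityˡ _)) 0≼-x)))

  0≼× : ∀ n {x} → 𝟘 ≼ x → 𝟘 ≼ (n × x)
  0≼× zero _ = ≼-refl 𝟘
  0≼× (suc n) 0≼x = 0≼⊕ 0≼x (0≼× n 0≼x)

  rep≈× : ∀ k x → rep k x ≈ (suc k × x)
  rep≈× zero x = ≈-sym (⊕-idʳ x)
  rep≈× (suc k) x = ⊕-cong ≈-refl (rep≈× k x)

  0≼n×x⇒0≼x : ∀ k {x} → 𝟘 ≼ (suc k × x) → 𝟘 ≼ x
  0≼n×x⇒0≼x k {x} 0≼kx = torsion-free-order k x (≼-cong ≈-refl (≈-sym (rep≈× k x)) 0≼kx)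

  n×x≈0⇒x≈0 : ∀ k {x} → (suc k × x) ≈ 𝟘 → x ≈ 𝟘
  n×x≈0⇒x≈0 k {x} kx≈0 = 0≼-antisym
    (0≼n×x⇒0≼x k (≼-cong ≈-refl (≈-sym kx≈0) (≼-refl 𝟘)))
    (0≼n×x⇒0≼x k (≼-cong ≈-refl (≈-sym k[-x]≈0) (≼-refl 𝟘)))
    where
    k[-x]≈0 : (suc k × (- x)) ≈ 𝟘
    k[-x]≈0 = ≈-trans (×-homo-‿ (suc k) x) (≈-trans (-‿cong kx≈0) -0#≈0#)

  Denotes : ℚᵘ → Carrier → Set
  Denotes r x = (ι (ℚᵘ.↧ r) ⊗ x) ≈ ι (ℚᵘ.↥ r)

  Denotes-unique : ∀ r {x y} → Denotes r x → Denotes r y → x ≈ y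
  Denotes-unique (mkℚᵘ a d) {x} {y} dx dy = x∙y⁻¹≈ε⇒x≈y x y (n×x≈0⇒x≈0 d (begin
    suc d × (x - y)          ≈⟨ ×1*≈× (suc d) (x - y) ⟨
    D ⊗ (x - y)              ≈⟨ solve 3 (λ D x y → D :* (x :- y) := D :* x :- D :* y) ≈-refl D x y ⟩
    (D ⊗ x) - (D ⊗ y)        ≈⟨ ⊕-cong dx (-‿cong dy) ⟩
    ι a - ι a                ≈⟨ x≈y⇒x∙y⁻¹≈ε ≈-refl ⟩
    𝟘                        ∎))
    where
    D : Carrier
    D = suc d × 𝟙

  Denotes-resp-≃ : ∀ {r s x} → r ℚᵘ.≃ s → Denotes r x → Denotes s x
  Denotes-resp-≃ {mkℚᵘ a d} {mkℚᵘ b e} {x} (*≡* a*e≡b*d) dx =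
    x∙y⁻¹≈ε⇒x≈y _ _ (n×x≈0⇒x≈0 d (begin
      suc d × ((E ⊗ x) - ι b)        ≈⟨ ×1*≈× (suc d) _ ⟨
      D ⊗ ((E ⊗ x) - ι b)            ≈⟨ solve 4 (λ D E x b → D :* (E :* x :- b) := E :* (D :* x) :- b :* D)
                                          ≈-refl D E x (ι b) ⟩
      (E ⊗ (D ⊗ x)) - (ι b ⊗ D)      ≈⟨ ⊕-cong (≈-trans (⊗-cong ≈-refl dx) (⊗-comm _ _)) ≈-refl ⟩
      (ι a ⊗ E) - (ι b ⊗ D)          ≈⟨ ⊕-cong (*-homo a (+ suc e)) (-‿cong (*-homo b (+ suc d))) ⟨
      ι (a ℤ.* + suc e) - ι (b ℤ.* + suc d) ≡⟨ ≡.cong (λ z → ι z - ι (b ℤ.* + suc d)) a*e≡b*d ⟩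
      ι (b ℤ.* + suc d) - ι (b ℤ.* + suc d) ≈⟨ x≈y⇒x∙y⁻¹≈ε ≈-refl ⟩
      𝟘                              ∎))
    where
    D E : Carrier
    D = suc d × 𝟙
    E = suc e × 𝟙

  Denotes-+ : ∀ r s {x y} → Denotes r x → Denotes s y → Denotes (r ℚᵘ.+ s) (x ⊕ y)
  Denotes-+ (mkℚᵘ a d) (mkℚᵘ b e) {x} {y} dx dy = begin
    ι (+ suc d ℤ.* + suc e) ⊗ (x ⊕ y)       ≈⟨ ⊗-cong (*-homo (+ suc d) (+ suc e)) ≈-refl ⟩
    (D ⊗ E) ⊗ (x ⊕ y)                       ≈⟨ solve 4 (λ D E x y → (D :* E) :* (x :+ y)
                                                             := (D :* x) :* E :+ (E :* y) :* D) ≈-refl D E x y ⟩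
    ((D ⊗ x) ⊗ E) ⊕ ((E ⊗ y) ⊗ D)           ≈⟨ ⊕-cong (⊗-cong dx ≈-refl) (⊗-cong dy ≈-refl) ⟩
    (ι a ⊗ E) ⊕ (ι b ⊗ D)                   ≈⟨ ⊕-cong (*-homo a (+ suc e)) (*-homo b (+ suc d)) ⟨
    ι (a ℤ.* + suc e) ⊕ ι (b ℤ.* + suc d)   ≈⟨ +-homo (a ℤ.* + suc e) (b ℤ.* + suc d) ⟨
    ι (a ℤ.* + suc e ℤ.+ b ℤ.* + suc d)     ∎
    where
    D E : Carrier
    D = suc d × 𝟙
    E = suc e × 𝟙

  Denotes-* : ∀ r s {x y} → Denotes r x → Denotes s y → Denotes (r ℚᵘ.* s) (x ⊗ y)
  Denotes-* (mkℚᵘ a d) (mkℚᵘ b e) {x} {y} dx dy = begin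
    ι (+ suc d ℤ.* + suc e) ⊗ (x ⊗ y)   ≈⟨ ⊗-cong (*-homo (+ suc d) (+ suc e)) ≈-refl ⟩
    (D ⊗ E) ⊗ (x ⊗ y)                   ≈⟨ solve 4 (λ D E x y → (D :* E) :* (x :* y) := (D :* x) :* (E :* y))
                                             ≈-refl D E x y ⟩
    (D ⊗ x) ⊗ (E ⊗ y)                   ≈⟨ ⊗-cong dx dy ⟩
    ι a ⊗ ι b                           ≈⟨ *-homo a b ⟨
    ι (a ℤ.* b)                         ∎
    where
    D E : Carrier
    D = suc d × 𝟙
    E = suc e × 𝟙

  reciprocal : ℕ → Carrier
  reciprocal k = proj₁ (divisible k)

  Denotes-reciprocal : ∀ a d → Denotes (mkℚᵘ a d) (ι a ⊗ reciprocal d)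
  Denotes-reciprocal a d = begin
    D ⊗ (ι a ⊗ reciprocal d)    ≈⟨ solve 3 (λ D a r → D :* (a :* r) := a :* (D :* r))
                                     ≈-refl D (ι a) (reciprocal d) ⟩
    ι a ⊗ (D ⊗ reciprocal d)    ≈⟨ ⊗-cong ≈-refl (≈-trans (×1*≈× (suc d) _) (≈-sym (rep≈× d _))) ⟩
    ι a ⊗ rep d (reciprocal d)  ≈⟨ ⊗-cong ≈-refl (proj₂ (divisible d)) ⟩
    ι a ⊗ 𝟙                     ≈⟨ ⊗-idʳ _ ⟩
    ι a                         ∎
    where
    D : Carrier
    D = suc d × 𝟙

  ⟦_⟧ℚ : ℚ → Carrier
  ⟦ mkℚ a d _ ⟧ℚ = ι a ⊗ reciprocal d

  Denotes-⟦⟧ℚ : ∀ q → Denotes (ℚ.toℚᵘ q) ⟦ q ⟧ℚ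
  Denotes-⟦⟧ℚ (mkℚ a d _) = Denotes-reciprocal a d

  ⟦⟧ℚ-+ : ∀ p q → ⟦ p ℚ.+ q ⟧ℚ ≈ (⟦ p ⟧ℚ ⊕ ⟦ q ⟧ℚ)
  ⟦⟧ℚ-+ p q = Denotes-unique (ℚ.toℚᵘ (p ℚ.+ q)) (Denotes-⟦⟧ℚ (p ℚ.+ q))
    (Denotes-resp-≃ (ℚᵘ.≃-sym (ℚ.toℚᵘ-homo-+ p q))
      (Denotes-+ (ℚ.toℚᵘ p) (ℚ.toℚᵘ q) (Denotes-⟦⟧ℚ p) (Denotes-⟦⟧ℚ q)))

  ⟦⟧ℚ-* : ∀ p q → ⟦ p ℚ.* q ⟧ℚ ≈ (⟦ p ⟧ℚ ⊗ ⟦ q ⟧ℚ)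
  ⟦⟧ℚ-* p q = Denotes-unique (ℚ.toℚᵘ (p ℚ.* q)) (Denotes-⟦⟧ℚ (p ℚ.* q))
    (Denotes-resp-≃ (ℚᵘ.≃-sym (ℚ.toℚᵘ-homo-* p q))
      (Denotes-* (ℚ.toℚᵘ p) (ℚ.toℚᵘ q) (Denotes-⟦⟧ℚ p) (Denotes-⟦⟧ℚ q)))

  ⟦0⟧ℚ≈𝟘 : ⟦ 0ℚ ⟧ℚ ≈ 𝟘
  ⟦0⟧ℚ≈𝟘 = Denotes-unique (ℚ.toℚᵘ 0ℚ) (Denotes-⟦⟧ℚ 0ℚ) (zeroʳ _)

  ⟦1⟧ℚ≈𝟙 : ⟦ 1ℚ ⟧ℚ ≈ 𝟙
  ⟦1⟧ℚ≈𝟙 = Denotes-unique (ℚ.toℚᵘ 1ℚ) (Denotes-⟦⟧ℚ 1ℚ) (⊗-idʳ _)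

  ⟦-1⟧ℚ≈-𝟙 : ⟦ ℚ.- 1ℚ ⟧ℚ ≈ (- 𝟙)
  ⟦-1⟧ℚ≈-𝟙 = Denotes-unique (ℚ.toℚᵘ (ℚ.- 1ℚ)) (Denotes-⟦⟧ℚ (ℚ.- 1ℚ))
    (≈-trans (×1*≈× 1 (- 𝟙)) (×-homo-‿ 1 𝟙))

  0≼⟦⟧ℚ⊗ : ∀ a {x} → 0ℚ ℚ.≤ a → 𝟘 ≼ x → 𝟘 ≼ (⟦ a ⟧ℚ ⊗ x)
  0≼⟦⟧ℚ⊗ a@(mkℚ (+ n) d _) {x} _ 0≼x = 0≼n×x⇒0≼x d (≼-cong ≈-refl (begin
    n × x                             ≈⟨ ×1*≈× n x ⟨
    ι (+ n) ⊗ x                       ≈⟨ ⊗-cong (Denotes-⟦⟧ℚ a) ≈-refl ⟨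
    ((suc d × 𝟙) ⊗ ⟦ a ⟧ℚ) ⊗ x        ≈⟨ ⊗-assoc _ _ _ ⟩
    (suc d × 𝟙) ⊗ (⟦ a ⟧ℚ ⊗ x)        ≈⟨ ×1*≈× (suc d) _ ⟩
    suc d × (⟦ a ⟧ℚ ⊗ x)              ∎) (0≼× n 0≼x))
  0≼⟦⟧ℚ⊗ (mkℚ -[1+ _ ] _ _) (ℚ.*≤* ()) _

  ⟦_⟧ : Poly X → Carrier
  ⟦ var x ⟧ = ⟦ x ⟧ᵛ
  ⟦ con q ⟧ = ⟦ q ⟧ℚ
  ⟦ p ⊞ q ⟧ = ⟦ p ⟧ ⊕ ⟦ q ⟧
  ⟦ p ⊠ q ⟧ = ⟦ p ⟧ ⊗ ⟦ q ⟧

  ⟦⊟⟧ : ∀ p → ⟦ ⊟ p ⟧ ≈ (- ⟦ p ⟧)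
  ⟦⊟⟧ p = ≈-trans (⊗-cong ⟦-1⟧ℚ≈-𝟙 ≈-refl) (-1*x≈-x ⟦ p ⟧)

  ⟦⟧-cong : ∀ {p q} → p ≈ₚ q → ⟦ p ⟧ ≈ ⟦ q ⟧
  ⟦⟧-cong refl≈ = ≈-refl
  ⟦⟧-cong (sym≈ e) = ≈-sym (⟦⟧-cong e)
  ⟦⟧-cong (trans≈ e f) = ≈-trans (⟦⟧-cong e) (⟦⟧-cong f)
  ⟦⟧-cong (⊞-cong e f) = ⊕-cong (⟦⟧-cong e) (⟦⟧-cong f)
  ⟦⟧-cong (⊠-cong e f) = ⊗-cong (⟦⟧-cong e) (⟦⟧-cong f)
  ⟦⟧-cong (⊞-assoc p q r) = ⊕-assoc _ _ _
  ⟦⟧-cong (⊞-comm p q) = ⊕-comm _ _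
  ⟦⟧-cong (⊞-idʳ p) = ≈-trans (⊕-cong ≈-refl ⟦0⟧ℚ≈𝟘) (⊕-idʳ _)
  ⟦⟧-cong (⊞-invʳ p) = ≈-trans (⊕-cong ≈-refl (⟦⊟⟧ p)) (≈-trans (x≈y⇒x∙y⁻¹≈ε ≈-refl) (≈-sym ⟦0⟧ℚ≈𝟘))
  ⟦⟧-cong (⊠-assoc p q r) = ⊗-assoc _ _ _
  ⟦⟧-cong (⊠-comm p q) = ⊗-comm _ _
  ⟦⟧-cong (⊠-idʳ p) = ≈-trans (⊗-cong ≈-refl ⟦1⟧ℚ≈𝟙) (⊗-idʳ _)
  ⟦⟧-cong (distribˡ p q r) = distrib _ _ _
  ⟦⟧-cong (con-+ a b) = ⟦⟧ℚ-+ a b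
  ⟦⟧-cong (con-* a b) = ⟦⟧ℚ-* a b

  eval-numeral : ∀ n → eval (numeral n) ≈ (n × 𝟙)
  eval-numeral zero = ≈-refl
  eval-numeral (suc n) = ⊕-cong ≈-refl (eval-numeral n)

  open Cleared using (den; pos; neg)

  eval-clear : ∀ p → (eval (pos (clear p)) - eval (neg (clear p))) ≈ ((den (clear p) × 𝟙) ⊗ ⟦ p ⟧)
  eval-clear (var x) = solve 1 (λ x → x :- con (+ 0) := con (+ 1) :* x) ≈-refl ⟦ x ⟧ᵛ
  eval-clear (con (mkℚ (+ k) d _)) =
    ≈-trans (⊕-cong (eval-numeral k) -0#≈0#) (≈-trans (⊕-idʳ _) (≈-sym (Denotes-reciprocal (+ k) d)))
  eval-clear (con (mkℚ -[1+ k ] d _)) =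
    ≈-trans (+-identityˡ _) (≈-trans (-‿cong (eval-numeral (suc k))) (≈-sym (Denotes-reciprocal -[1+ k ] d)))
  eval-clear (p ⊞ q) with clear p | eval-clear p | clear q | eval-clear q
  ... | cleared d₁ a₁ b₁ | H₁ | cleared d₂ a₂ b₂ | H₂ = begin
    ((N₂ ⊗ A₁) ⊕ (N₁ ⊗ A₂)) - ((N₂ ⊗ B₁) ⊕ (N₁ ⊗ B₂))
      ≈⟨ solve 6 (λ N₁ N₂ A₁ A₂ B₁ B₂ →
           ((N₂ :* A₁) :+ (N₁ :* A₂)) :- ((N₂ :* B₁) :+ (N₁ :* B₂)) := N₂ :* (A₁ :- B₁) :+ N₁ :* (A₂ :- B₂))
           ≈-refl N₁ N₂ A₁ A₂ B₁ B₂ ⟩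
    (N₂ ⊗ (A₁ - B₁)) ⊕ (N₁ ⊗ (A₂ - B₂))
      ≈⟨ ⊕-cong (⊗-cong (eval-numeral d₂) H₁) (⊗-cong (eval-numeral d₁) H₂) ⟩
    (D₂ ⊗ (D₁ ⊗ ⟦ p ⟧)) ⊕ (D₁ ⊗ (D₂ ⊗ ⟦ q ⟧))
      ≈⟨ solve 4 (λ D₁ D₂ x y → (D₂ :* (D₁ :* x)) :+ (D₁ :* (D₂ :* y)) := (D₁ :* D₂) :* (x :+ y))
           ≈-refl D₁ D₂ ⟦ p ⟧ ⟦ q ⟧ ⟩
    (D₁ ⊗ D₂) ⊗ (⟦ p ⟧ ⊕ ⟦ q ⟧)
      ≈⟨ ⊗-cong (×1-homo-* d₁ d₂) ≈-refl ⟨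
    ((d₁ ℕ.* d₂) × 𝟙) ⊗ (⟦ p ⟧ ⊕ ⟦ q ⟧) ∎
    where
    N₁ N₂ D₁ D₂ A₁ A₂ B₁ B₂ : Carrier
    N₁ = eval (numeral d₁)
    N₂ = eval (numeral d₂)
    D₁ = d₁ × 𝟙
    D₂ = d₂ × 𝟙
    A₁ = eval a₁
    A₂ = eval a₂
    B₁ = eval b₁
    B₂ = eval b₂
  eval-clear (p ⊠ q) with clear p | eval-clear p | clear q | eval-clear q
  ... | cleared d₁ a₁ b₁ | H₁ | cleared d₂ a₂ b₂ | H₂ = begin
    ((A₁ ⊗ A₂) ⊕ (B₁ ⊗ B₂)) - ((A₁ ⊗ B₂) ⊕ (B₁ ⊗ A₂))
      ≈⟨ solve 4 (λ A₁ A₂ B₁ B₂ →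
           ((A₁ :* A₂) :+ (B₁ :* B₂)) :- ((A₁ :* B₂) :+ (B₁ :* A₂)) := (A₁ :- B₁) :* (A₂ :- B₂))
           ≈-refl A₁ A₂ B₁ B₂ ⟩
    (A₁ - B₁) ⊗ (A₂ - B₂)
      ≈⟨ ⊗-cong H₁ H₂ ⟩
    (D₁ ⊗ ⟦ p ⟧) ⊗ (D₂ ⊗ ⟦ q ⟧)
      ≈⟨ solve 4 (λ D₁ D₂ x y → (D₁ :* x) :* (D₂ :* y) := (D₁ :* D₂) :* (x :* y)) ≈-refl D₁ D₂ ⟦ p ⟧ ⟦ q ⟧ ⟩
    (D₁ ⊗ D₂) ⊗ (⟦ p ⟧ ⊗ ⟦ q ⟧)
      ≈⟨ ⊗-cong (×1-homo-* d₁ d₂) ≈-refl ⟨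
    ((d₁ ℕ.* d₂) × 𝟙) ⊗ (⟦ p ⟧ ⊗ ⟦ q ⟧) ∎
    where
    D₁ D₂ A₁ A₂ B₁ B₂ : Carrier
    D₁ = d₁ × 𝟙
    D₂ = d₂ × 𝟙
    A₁ = eval a₁
    A₂ = eval a₂
    B₁ = eval b₁
    B₂ = eval b₂

  eval-clear-suc : ∀ p → ∃ λ k → (eval (pos (clear p)) - eval (neg (clear p))) ≈ (suc k × ⟦ p ⟧)
  eval-clear-suc p with clear-den≡suc p
  ... | k , den≡suc-k =
    k , ≈-trans (eval-clear p) (≈-trans (×1*≈× (den (clear p)) ⟦ p ⟧) (×-congˡ den≡suc-k))

  Sat0≤⇔0≼⟦⟧ : ∀ p → Sat0≤ M p ⇔ (𝟘 ≼ ⟦ p ⟧)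
  Sat0≤⇔0≼⟦⟧ p with eval-clear-suc p
  ... | k , e = mk⇔
    (λ sat → 0≼n×x⇒0≼x k (≼-cong ≈-refl e (x≼y⇒0≼y-x sat)))
    (λ 0≼⟦p⟧ → 0≼y-x⇒x≼y (≼-cong ≈-refl (≈-sym e) (0≼× (suc k) 0≼⟦p⟧)))

  Sat0=⇔⟦⟧≈0 : ∀ p → Sat0= M p ⇔ (⟦ p ⟧ ≈ 𝟘)
  Sat0=⇔⟦⟧≈0 p with eval-clear-suc p
  ... | k , e = mk⇔
    (λ sat → n×x≈0⇒x≈0 k (≈-trans (≈-sym e) (x≈y⇒x∙y⁻¹≈ε (≈-sym sat))))
    (λ ⟦p⟧≈0 → ≈-sym (x∙y⁻¹≈ε⇒x≈y _ _ (≈-trans e (≈-trans (×-congʳ (suc k) ⟦p⟧≈0) (×-zeroʳ (suc k))))))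

  ¬0≼-𝟙 : ¬ (𝟘 ≼ (- 𝟙))
  ¬0≼-𝟙 0≼-1 = 0≉1 (≼-antisym 0≼1 (0≼y-x⇒x≼y (≼-cong ≈-refl (≈-sym (+-identityˡ _)) 0≼-1)))

module ConeModel {X : Set} {C : Poly X → Set} (cone : IsCone C) (regular : IsRegular C) where
  open Polynomials {X}
  open import Relation.Binary.Reasoning.Setoid (CommutativeRing.setoid commutativeRing)
  open IsCone cone using ()
    renaming (respects to C-resp; closed-+ to ⊞-∈C; closed-nonneg-scale to scale-∈C)
  open IsRegular regular
  open IsIdeal units-ideal using ()
    renaming (respects to units-resp; has-0 to 0∈units; closed-+ to ⊞-∈units;
              closed-neg to ⊟-∈units; closed-mul to ⊠-∈units)

  ≈ₚ⇒⊟∈units : ∀ {p q} → p ≈ₚ q → units C (p ⊟ q)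
  ≈ₚ⇒⊟∈units {p} {q} p≈q = units-resp (sym≈ (trans≈ (⊞-cong p≈q refl≈) (⊞-invʳ q))) 0∈units

  rep≈ₚ× : ∀ k x → Structure.rep (𝔐 C) k x ≈ₚ (suc k × x)
  rep≈ₚ× zero x = sym≈ (⊞-idʳ x)
  rep≈ₚ× (suc k) x = ⊞-cong refl≈ (rep≈ₚ× k x)

  1/suc⊠× : ∀ k x → con (1/suc k) ⊠ (suc k × x) ≈ₚ x
  1/suc⊠× k x = begin
    con (1/suc k) ⊠ (suc k × x)                 ≈⟨ ⊠-cong refl≈ (×1*≈× (suc k) x) ⟨
    con (1/suc k) ⊠ ((suc k × con 1ℚ) ⊠ x)      ≈⟨ ⊠-cong refl≈ (⊠-cong (ι≈ₚcon∘fromℤ (+ suc k)) refl≈) ⟩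
    con (1/suc k) ⊠ (con (fromℤ (+ suc k)) ⊠ x) ≈⟨ ⊠-assoc _ _ x ⟨
    (con (1/suc k) ⊠ con (fromℤ (+ suc k))) ⊠ x ≈⟨ ⊠-cong (trans≈ (⊠-comm _ _) (sym≈ (con-* _ _))) refl≈ ⟩
    con (fromℤ (+ suc k) ℚ.* 1/suc k) ⊠ x       ≈⟨ ⊠-cong (con-cong (fromℤ-↧*≡↥ (1/suc k))) refl≈ ⟩
    con 1ℚ ⊠ x                                  ≈⟨ trans≈ (⊠-comm _ x) (⊠-idʳ x) ⟩
    x                                           ∎

  1∈units⇒C-full : units C (con 1ℚ) → ∀ p → C p
  1∈units⇒C-full 1∈units p = proj₁ (units-resp (⊠-idʳ p) (⊠-∈units p 1∈units))

  rep-1/suc≈ₚ1 : ∀ k → Structure.rep (𝔐 C) k (con (1/suc k)) ≈ₚ con 1ℚ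
  rep-1/suc≈ₚ1 k = begin
    Structure.rep (𝔐 C) k (con (1/suc k))  ≈⟨ rep≈ₚ× k _ ⟩
    suc k × con (1/suc k)                  ≈⟨ ×1*≈× (suc k) _ ⟨
    (suc k × con 1ℚ) ⊠ con (1/suc k)       ≈⟨ ⊠-comm _ _ ⟩
    con (1/suc k) ⊠ (suc k × con 1ℚ)       ≈⟨ 1/suc⊠× k (con 1ℚ) ⟩
    con 1ℚ                                 ∎

  torsion-free : ∀ k x → C (Structure.rep (𝔐 C) k x ⊟ con 0ℚ) → C (x ⊟ con 0ℚ)
  torsion-free k x 0≼kx = C-resp (begin
    con (1/suc k) ⊠ (Structure.rep (𝔐 C) k x ⊟ con 0ℚ)
      ≈⟨ solve 2 (λ r y → r :* (y :- con (+ 0)) := r :* y :- con (+ 0)) refl≈ (con (1/suc k)) _ ⟩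
    (con (1/suc k) ⊠ Structure.rep (𝔐 C) k x) ⊟ con 0ℚ
      ≈⟨ ⊞-cong (trans≈ (⊠-cong refl≈ (rep≈ₚ× k x)) (1/suc⊠× k x)) refl≈ ⟩
    x ⊟ con 0ℚ ∎) (scale-∈C (0≤1/suc k) 0≼kx)

  isLRR : IsConsistent C → IsLRR (𝔐 C)
  isLRR consistent = record
    { ≈-refl = ≈ₚ⇒⊟∈units refl≈
    ; ≈-sym = λ {x} {y} x≈y → units-resp (solve 2 (λ x y → :- (x :- y) := y :- x) refl≈ x y) (⊟-∈units x≈y)
    ; ≈-trans = λ {x} {y} {z} x≈y y≈z →
        units-resp (solve 3 (λ x y z → (x :- y) :+ (y :- z) := x :- z) refl≈ x y z) (⊞-∈units x≈y y≈z)
    ; ⊕-cong = λ {x} {x′} {y} {y′} x≈x′ y≈y′ →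
        units-resp (solve 4 (λ x x′ y y′ → (x :- x′) :+ (y :- y′) := (x :+ y) :- (x′ :+ y′)) refl≈ x x′ y y′)
          (⊞-∈units x≈x′ y≈y′)
    ; ⊗-cong = λ {x} {x′} {y} {y′} x≈x′ y≈y′ →
        units-resp (solve 4 (λ x x′ y y′ → (y :* (x :- x′)) :+ (x′ :* (y :- y′)) := (x :* y) :- (x′ :* y′))
                      refl≈ x x′ y y′)
          (⊞-∈units (⊠-∈units y x≈x′) (⊠-∈units x′ y≈y′))
    ; ≼-cong = λ {x} {x′} {y} {y′} x≈x′ y≈y′ x≼y →
        C-resp (solve 4 (λ x x′ y y′ → ((y :- x) :+ (x :- x′)) :+ (:- (y :- y′)) := y′ :- x′) refl≈ x x′ y y′)
          (⊞-∈C (⊞-∈C x≼y (proj₁ x≈x′)) (proj₂ y≈y′))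
    ; ⊕-assoc = λ x y z → ≈ₚ⇒⊟∈units (⊞-assoc x y z)
    ; ⊕-comm = λ x y → ≈ₚ⇒⊟∈units (⊞-comm x y)
    ; ⊕-idʳ = λ x → ≈ₚ⇒⊟∈units (⊞-idʳ x)
    ; ⊕-inv = λ x → ⊟ x , ≈ₚ⇒⊟∈units (⊞-invʳ x)
    ; ⊗-assoc = λ x y z → ≈ₚ⇒⊟∈units (⊠-assoc x y z)
    ; ⊗-comm = λ x y → ≈ₚ⇒⊟∈units (⊠-comm x y)
    ; ⊗-idʳ = λ x → ≈ₚ⇒⊟∈units (⊠-idʳ x)
    ; distrib = λ x y z → ≈ₚ⇒⊟∈units (distribˡ x y z)
    ; ≼-refl = λ x → proj₁ (≈ₚ⇒⊟∈units (refl≈ {p = x}))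
    ; ≼-trans = λ {x} {y} {z} x≼y y≼z →
        C-resp (solve 3 (λ x y z → (z :- y) :+ (y :- x) := z :- x) refl≈ x y z) (⊞-∈C y≼z x≼y)
    ; ≼-antisym = λ {x} {y} x≼y y≼x → y≼x , C-resp (solve 2 (λ x y → y :- x := :- (x :- y)) refl≈ x y) x≼y
    ; ≼-+ = λ {x} {y} z x≼y → C-resp (solve 3 (λ x y z → y :- x := (y :+ z) :- (x :+ z)) refl≈ x y z) x≼y
    ; 0≼1 = C-resp (solve 1 (λ o → o := o :- con (+ 0)) refl≈ (con 1ℚ)) has-1
    ; 0≉1 = λ 0≈1 → consistent (1∈units⇒C-full
        (units-resp (solve 1 (λ o → :- (con (+ 0) :- o) := o) refl≈ (con 1ℚ)) (⊟-∈units 0≈1)))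
    ; divisible = λ k → con (1/suc k) , ≈ₚ⇒⊟∈units (rep-1/suc≈ₚ1 k)
    ; torsion-free-order = torsion-free
    }

  module _ (consistent : IsConsistent C) where
    open LRRModel (𝔐 C) (isLRR consistent)
      using (⟦_⟧; Denotes-unique; Denotes-⟦⟧ℚ; Sat0≤⇔0≼⟦⟧; Sat0=⇔⟦⟧≈0) renaming (ι to ι𝔐)

    -- Both are z ↦ z·1 on ℚ[X], but they are built from rings with different
    -- equalities (units(C) versus ≈ₚ), so they only agree propositionally.
    ι𝔐≡ι : ∀ z → ι𝔐 z ≡ ι z
    ι𝔐≡ι (+ n) = ι𝔐≡ι⁺ n
      where
      ι𝔐≡ι⁺ : ∀ n → ι𝔐 (+ n) ≡ ι (+ n)
      ι𝔐≡ι⁺ zero = ≡.refl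
      ι𝔐≡ι⁺ (suc n) = ≡.cong (con 1ℚ ⊞_) (ι𝔐≡ι⁺ n)
    ι𝔐≡ι -[1+ n ] = ≡.cong ⊟_ (ι𝔐≡ι (+ suc n))

    ⟦p⟧⊟p∈units : ∀ p → units C (⟦ p ⟧ ⊟ p)
    ⟦p⟧⊟p∈units (var x) = ≈ₚ⇒⊟∈units refl≈
    ⟦p⟧⊟p∈units (con q@(mkℚ _ _ _)) =
      Denotes-unique (ℚ.toℚᵘ q) {y = con q} (Denotes-⟦⟧ℚ q) (≈ₚ⇒⊟∈units (begin
        ι𝔐 (ℚ.↧ q) ⊠ con q  ≡⟨ ≡.cong (_⊠ con q) (ι𝔐≡ι (ℚ.↧ q)) ⟩
        ι (ℚ.↧ q) ⊠ con q   ≈⟨ ι↧⊠con≈ₚι↥ q ⟩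
        ι (ℚ.↥ q)           ≡⟨ ι𝔐≡ι (ℚ.↥ q) ⟨
        ι𝔐 (ℚ.↥ q)          ∎))
    ⟦p⟧⊟p∈units (p ⊞ q) =
      units-resp (solve 4 (λ a p b q → (a :- p) :+ (b :- q) := (a :+ b) :- (p :+ q)) refl≈ ⟦ p ⟧ p ⟦ q ⟧ q)
        (⊞-∈units (⟦p⟧⊟p∈units p) (⟦p⟧⊟p∈units q))
    ⟦p⟧⊟p∈units (p ⊠ q) =
      units-resp (solve 4 (λ a p b q → (b :* (a :- p)) :+ (p :* (b :- q)) := (a :* b) :- (p :* q))
                    refl≈ ⟦ p ⟧ p ⟦ q ⟧ q)
        (⊞-∈units (⊠-∈units ⟦ q ⟧ (⟦p⟧⊟p∈units p)) (⊠-∈units p (⟦p⟧⊟p∈units q)))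

    Sat0≤⇔∈C : ∀ p → Sat0≤ (𝔐 C) p ⇔ C p
    Sat0≤⇔∈C p = mk⇔
      (λ sat → C-resp (solve 2 (λ a p → (a :- con (+ 0)) :+ (:- (a :- p)) := p) refl≈ ⟦ p ⟧ p)
                 (⊞-∈C (Equivalence.to (Sat0≤⇔0≼⟦⟧ p) sat) (proj₂ (⟦p⟧⊟p∈units p))))
      (λ p∈C → Equivalence.from (Sat0≤⇔0≼⟦⟧ p)
                 (C-resp (solve 2 (λ a p → p :+ (a :- p) := a :- con (+ 0)) refl≈ ⟦ p ⟧ p)
                   (⊞-∈C p∈C (proj₁ (⟦p⟧⊟p∈units p)))))

    Sat0=⇒∈units : ∀ p → Sat0= (𝔐 C) p → units C p
    Sat0=⇒∈units p sat =
      units-resp (solve 2 (λ a p → (a :- con (+ 0)) :+ (:- (a :- p)) := p) refl≈ ⟦ p ⟧ p)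
        (⊞-∈units (Equivalence.to (Sat0=⇔⟦⟧≈0 p) sat) (⊟-∈units (⟦p⟧⊟p∈units p)))

module PositiveCone {X : Set} (M : Structure X) (isLRR : IsLRR M) where
  open Structure M
  open IsLRR isLRR
  open LRRModel M isLRR

  Positive : Poly X → Set
  Positive p = 𝟘 ≼ ⟦ p ⟧

  units-Positive⇔⟦⟧≈0 : ∀ p → units Positive p ⇔ (⟦ p ⟧ ≈ 𝟘)
  units-Positive⇔⟦⟧≈0 p = mk⇔
    (λ (0≼⟦p⟧ , 0≼⟦⊟p⟧) → 0≼-antisym 0≼⟦p⟧ (≼-cong ≈-refl (⟦⊟⟧ p) 0≼⟦⊟p⟧))
    (λ ⟦p⟧≈0 → ≼-cong ≈-refl (≈-sym ⟦p⟧≈0) (≼-refl 𝟘)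
             , ≼-cong ≈-refl (≈-sym (≈-trans (⟦⊟⟧ p) (≈-trans (-‿cong ⟦p⟧≈0) -0#≈0#))) (≼-refl 𝟘))

  isCone : IsCone Positive
  isCone = record
    { respects = λ p≈q → ≼-cong ≈-refl (⟦⟧-cong p≈q)
    ; has-0 = ≼-cong ≈-refl (≈-sym ⟦0⟧ℚ≈𝟘) (≼-refl 𝟘)
    ; closed-+ = 0≼⊕
    ; closed-nonneg-scale = λ {a} → 0≼⟦⟧ℚ⊗ a }

  isRegular : IsRegular Positive
  isRegular = record
    { has-1 = ≼-cong ≈-refl (≈-sym ⟦1⟧ℚ≈𝟙) 0≼1
    ; units-ideal = record
      { respects = λ {p} {q} p≈q p∈U → ⟦⟧≈0⇒∈U q (≈-trans (⟦⟧-cong (sym≈ p≈q)) (∈U⇒⟦⟧≈0 p p∈U))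
      ; has-0 = ⟦⟧≈0⇒∈U (con 0ℚ) ⟦0⟧ℚ≈𝟘
      ; closed-+ = λ {p} {q} p∈U q∈U →
          ⟦⟧≈0⇒∈U (p ⊞ q) (≈-trans (⊕-cong (∈U⇒⟦⟧≈0 p p∈U) (∈U⇒⟦⟧≈0 q q∈U)) (⊕-idʳ 𝟘))
      ; closed-neg = λ {p} p∈U →
          ⟦⟧≈0⇒∈U (⊟ p) (≈-trans (⟦⊟⟧ p) (≈-trans (-‿cong (∈U⇒⟦⟧≈0 p p∈U)) -0#≈0#))
      ; closed-mul = λ r {p} p∈U →
          ⟦⟧≈0⇒∈U (r ⊠ p) (≈-trans (⊗-cong ≈-refl (∈U⇒⟦⟧≈0 p p∈U)) (zeroʳ _)) } }
    where
    ∈U⇒⟦⟧≈0 : ∀ p → units Positive p → ⟦ p ⟧ ≈ 𝟘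
    ∈U⇒⟦⟧≈0 p = Equivalence.to (units-Positive⇔⟦⟧≈0 p)

    ⟦⟧≈0⇒∈U : ∀ p → ⟦ p ⟧ ≈ 𝟘 → units Positive p
    ⟦⟧≈0⇒∈U p = Equivalence.from (units-Positive⇔⟦⟧≈0 p)

-- Imported only here: above, _×_ is the multiplication of ring elements by naturals.
open import Data.Product using (_×_)

⊨formulaF⇔ : {X : Set} (M : Structure X) (P Q R : List (Poly X)) →
  M ⊨ formulaF P Q R ⇔ (All (Sat0≤ M) P × All (λ q → ¬ Sat0≤ M q) Q × All (λ r → ¬ Sat0= M r) R)
⊨formulaF⇔ M P Q R = mk⇔
  (λ sat → let satP , satQR = ++⁻ (map 0≤_ P) sat ; satQ , satR = ++⁻ (map ¬0≤_ Q) satQR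
           in map⁻ satP , map⁻ satQ , map⁻ satR)
  (λ (satP , satQ , satR) → ++⁺ (map⁺ satP) (++⁺ (map⁺ satQ) (map⁺ satR)))

module Soundness {X : Set} {P Q R : List (Poly X)} {C : Poly X → Set}
                 (isLeast : IsLeastRegularConeContaining P C)
                 {M : Structure X} (isLRR : IsLRR M) (M⊨F : M ⊨ formulaF P Q R) where
  open IsLeastRegularConeContaining isLeast
  open IsLRR isLRR using (≼-cong; ≈-refl)
  open LRRModel M isLRR using (⟦-1⟧ℚ≈-𝟙; ¬0≼-𝟙; Sat0≤⇔0≼⟦⟧; Sat0=⇔⟦⟧≈0)
  open PositiveCone M isLRR
  open ConeModel cone regular using (Sat0≤⇔∈C; Sat0=⇒∈units)
  open Equivalence

  M⊨P : All (Sat0≤ M) P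
  M⊨P = proj₁ (to (⊨formulaF⇔ M P Q R) M⊨F)

  M⊭Q : All (λ q → ¬ Sat0≤ M q) Q
  M⊭Q = proj₁ (proj₂ (to (⊨formulaF⇔ M P Q R) M⊨F))

  M⊭R : All (λ r → ¬ Sat0= M r) R
  M⊭R = proj₂ (proj₂ (to (⊨formulaF⇔ M P Q R) M⊨F))

  C⊆Positive : ∀ {p} → C p → Positive p
  C⊆Positive {p} = least Positive isCone isRegular (All.map (λ {p} → to (Sat0≤⇔0≼⟦⟧ p)) M⊨P) p

  consistent : IsConsistent C
  consistent C-full = ¬0≼-𝟙 (≼-cong ≈-refl ⟦-1⟧ℚ≈-𝟙 (C⊆Positive (C-full (con (ℚ.- 1ℚ)))))

  ¬Sat0≤-transfer : ∀ q → ¬ Sat0≤ M q → ¬ Sat0≤ (𝔐 C) q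
  ¬Sat0≤-transfer q M⊭q 𝔐⊨q = M⊭q (from (Sat0≤⇔0≼⟦⟧ q) (C⊆Positive (to (Sat0≤⇔∈C consistent q) 𝔐⊨q)))

  ¬Sat0=-transfer : ∀ r → ¬ Sat0= M r → ¬ Sat0= (𝔐 C) r
  ¬Sat0=-transfer r M⊭r 𝔐⊨r = M⊭r (from (Sat0=⇔⟦⟧≈0 r) (to (units-Positive⇔⟦⟧≈0 r)
    (C⊆Positive (proj₁ r∈units) , C⊆Positive (proj₂ r∈units))))
    where
    r∈units : units C r
    r∈units = Sat0=⇒∈units consistent r 𝔐⊨r

  𝔐⊨F : 𝔐 C ⊨ formulaF P Q R
  𝔐⊨F = from (⊨formulaF⇔ (𝔐 C) P Q R)
    ( All.map (λ {p} → from (Sat0≤⇔∈C consistent p)) contains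
    , All.map (λ {q} → ¬Sat0≤-transfer q) M⊭Q
    , All.map (λ {r} → ¬Sat0=-transfer r) M⊭R )

theorem3p6 : {X : Set} (P Q R : List (Poly X)) (C : Poly X → Set) →
    IsLeastRegularConeContaining P C →
    SatisfiableModLRR (formulaF P Q R) ⇔ (IsConsistent C × (𝔐 C ⊨ formulaF P Q R))
theorem3p6 P Q R C isLeast = mk⇔
  (λ (M , isLRR , M⊨F) → let open Soundness {Q = Q} {R} isLeast isLRR M⊨F in consistent , 𝔐⊨F)
  (λ (consistent , 𝔐⊨F) → 𝔐 C , ConeModel.isLRR cone regular consistent , 𝔐⊨F)
  where open IsLeastRegularConeContaining isLeast using (cone; regular)
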